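{- Let $n\geq 1$ and $x\in\{1,\dots,n\}$. Let $k\geq 2$ satisfy $F_k\leq x<F_{k+1}$ and let $\ell\geq k$ satisfy $F_\ell\leq x+n<F_{\ell+1}$. Then the degree of $x$ in $G_n$ is $$\deg_{G_n}(x)=\begin{cases}\ell-k & \text{if } 2x \text{ is not a Fibonacci number},\\ \ell-k-1 & \text{if } 2x \text{ is a Fibonacci number}.\end{cases}$$
   Context: The Fibonacci numbers are defined by $F_0=0$, $F_1=1$ and $F_m=F_{m-1}+F_{m-2}$ for $m\geq 2$. For each integer $n\geq 1$, the Fibonacci-sum graph $G_n$ is the simple graph with vertex set $\{1,2,\dots,n\}$ in which distinct vertices $i,j$ are adjacent if and only if $i+j$ is a Fibonacci number. -}

module Defs where

open import Data.Nat using (ℕ; zero; suc; _+_; _*_; _∸_; _≤_; _<_)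
open import Data.Product using (Σ; ∃; _×_; _,_)
open import Relation.Binary.PropositionalEquality using (_≡_; _≢_)

fib : ℕ → ℕ
fib zero = 0
fib (suc zero) = 1
fib (suc (suc m)) = fib (suc m) + fib m

IsFib : ℕ → Set
IsFib m = ∃ λ k → fib k ≡ m

Vertex : ℕ → ℕ → Set
Vertex n i = (1 ≤ i) × (i ≤ n)

Adj : ℕ → ℕ → ℕ → Set
Adj n i j = Vertex n i × Vertex n j × (i ≢ j) × IsFib (i + j)

module Submission where

-- A vertex y of G n is a
-- "Fibonacci partner" of x when x + y = F j for some j.  Since x < x + y ≤ x + n,
-- monotonicity of F forces k < j ≤ ℓ; conversely every such j gives the
-- partner F j ∸ x, which lies in {1,…,n}.  As F is strictly increasing from
-- index 2 on, these ℓ ∸ k partners are distinct, so they form a duplicate-free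
-- list `partners` of length ℓ ∸ k (`partner→listed`, `listed→partner`).
-- The neighbours of x are its partners other than x itself, and x is its own
-- partner exactly when F j = 2x for some j.  Two general counting facts about
-- duplicate-free lists (`length-without`, `length-remove`) then give degree
-- ℓ ∸ k or ℓ ∸ k ∸ 1 respectively.

open import Defs
open import Data.Nat using (ℕ; zero; suc; _+_; _*_; _∸_; _≤_; _<_; _≤′_; ≤′-refl; ≤′-step; z≤n; s≤s; _≟_; _<?_)
open import Data.Nat.Properties
open import Data.Product using (_×_; _,_; proj₁; proj₂)
open import Data.List using (List; _∷_; length; applyUpTo)
open import Data.List.Properties using (length-applyUpTo)
open import Data.List.Membership.Propositional using (_∈_; _∉_)
open import Data.List.Membership.Propositional.Properties using (∈-applyUpTo⁺; ∈-applyUpTo⁻)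
open import Data.List.Membership.Propositional.Properties.WithK using (unique∧set⇒bag)
open import Data.List.Relation.Binary.BagAndSetEquality using (∼bag⇒↭)
open import Data.List.Relation.Binary.Permutation.Propositional.Properties using (↭-length)
open import Data.List.Relation.Unary.Any using (here; there)
open import Data.List.Relation.Unary.All as All using ()
open import Data.List.Relation.Unary.AllPairs using (_∷_)
open import Data.List.Relation.Unary.Unique.Propositional using (Unique)
open import Data.List.Relation.Unary.Unique.Propositional.Properties using (applyUpTo⁺₁)
open import Function.Bundles using (_⇔_; mk⇔; Equivalence)
open import Relation.Nullary using (¬_; yes; no; contradiction)
open import Relation.Binary.Definitions using (DecidableEquality)
open import Relation.Binary.PropositionalEquality using (_≡_; _≢_; refl; sym; trans; cong; subst; module ≡-Reasoning)

private
  variable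
    A : Set

length-unique-set : {xs ys : List A} → Unique xs → Unique ys →
  (∀ {z} → z ∈ xs ⇔ z ∈ ys) → length xs ≡ length ys
length-unique-set ux uy same = ↭-length (∼bag⇒↭ (unique∧set⇒bag ux uy same))

length-without : {x : A} {N M : List A} → Unique N → Unique M → x ∉ M →
  (∀ y → y ∈ N ⇔ (y ∈ M × x ≢ y)) → length N ≡ length M
length-without {x = x} {N} {M} uN uM x∉M spec = length-unique-set uN uM (mk⇔ to from)
  where
  to : ∀ {y} → y ∈ N → y ∈ M
  to p = proj₁ (Equivalence.to (spec _) p)
  from : ∀ {y} → y ∈ M → y ∈ N
  from p = Equivalence.from (spec _) (p , λ { refl → x∉M p })

-- If N enumerates the elements of M different from x, and x ∈ M, then N has
-- one element fewer than M: x ∷ N enumerates M exactly.  Telling x apart from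
-- the other elements of M needs decidable equality.
length-remove : DecidableEquality A → {x : A} {N M : List A} →
  Unique N → Unique M → x ∈ M →
  (∀ y → y ∈ N ⇔ (y ∈ M × x ≢ y)) → length N ≡ length M ∸ 1
length-remove _≟_ {x} {N} {M} uN uM x∈M spec =
  cong (_∸ 1) (length-unique-set uxN uM (mk⇔ to from))
  where
  uxN : Unique (x ∷ N)
  uxN = All.tabulate (λ p → proj₂ (Equivalence.to (spec _) p)) ∷ uN
  to : ∀ {y} → y ∈ x ∷ N → y ∈ M
  to (here refl) = x∈M
  to (there p)   = proj₁ (Equivalence.to (spec _) p)
  from : ∀ {y} → y ∈ M → y ∈ x ∷ N
  from {y} p with y ≟ x
  ... | yes y≡x = here y≡x
  ... | no  y≢x = there (Equivalence.from (spec y) (p , λ x≡y → y≢x (sym x≡y)))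

fib-≤-suc : ∀ m → fib m ≤ fib (suc m)
fib-≤-suc zero          = z≤n
fib-≤-suc (suc zero)    = ≤-refl
fib-≤-suc (suc (suc m)) = m≤m+n (fib (suc (suc m))) (fib (suc m))

fib-mono : ∀ {m n} → m ≤ n → fib m ≤ fib n
fib-mono m≤n = go (≤⇒≤′ m≤n)
  where
  go : ∀ {m n} → m ≤′ n → fib m ≤ fib n
  go ≤′-refl                 = ≤-refl
  go {n = suc n} (≤′-step p) = ≤-trans (go p) (fib-≤-suc n)

fib-<-reflect : ∀ {m n} → fib m < fib n → m < n
fib-<-reflect {m} {n} Fm<Fn with m <? n
... | yes m<n = m<n
... | no  m≮n = contradiction (fib-mono (≮⇒≥ m≮n)) (<⇒≱ Fm<Fn)

-- … and strictly increasing from index 2 on (F 1 = F 2 is the only repetition).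
fib-<-suc : ∀ m → 2 ≤ m → fib m < fib (suc m)
fib-<-suc (suc zero)    (s≤s ())
fib-<-suc (suc (suc m)) _ =
  subst (_≤ fib (suc (suc m)) + fib (suc m)) (+-comm (fib (suc (suc m))) 1)
    (+-monoʳ-≤ (fib (suc (suc m))) (fib-mono {1} {suc m} (s≤s z≤n)))

fib-strict : ∀ {m n} → 2 ≤ m → m < n → fib m < fib n
fib-strict {m} 2≤m m<n = <-≤-trans (fib-<-suc m 2≤m) (fib-mono m<n)

Partner : ℕ → ℕ → ℕ → Set
Partner n x y = Vertex n y × IsFib (x + y)

adj⇔partner : ∀ {n x y} → Vertex n x → Adj n x y ⇔ (Partner n x y × x ≢ y)
adj⇔partner x∈G = mk⇔ (λ (_ , y∈G , x≢y , isFib) → (y∈G , isFib) , x≢y)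
                      (λ ((y∈G , isFib) , x≢y) → x∈G , y∈G , x≢y , isFib)

self-partner : ∀ {n x} → Vertex n x → IsFib (2 * x) → Partner n x x
self-partner {x = x} x∈G fib2x = x∈G , subst IsFib (cong (x +_) (+-identityʳ x)) fib2x

partner-self : ∀ {n x} → Partner n x x → IsFib (2 * x)
partner-self {x = x} (_ , fibx+x) = subst IsFib (cong (x +_) (sym (+-identityʳ x))) fibx+x

-- Under the hypotheses of the theorem the partners of x are exactly the
-- numbers F j ∸ x with k < j ≤ ℓ, listed here as F (i + k + 1) ∸ x, i < ℓ ∸ k.
module Partners (n x k ℓ : ℕ) (2≤k : 2 ≤ k) (Fk≤x : fib k ≤ x) (x<Fk+1 : x < fib (suc k))
                (k≤ℓ : k ≤ ℓ) (Fℓ≤x+n : fib ℓ ≤ x + n) (x+n<Fℓ+1 : x + n < fib (suc ℓ)) where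

  partner : ℕ → ℕ
  partner i = fib (i + suc k) ∸ x

  partners : List ℕ
  partners = applyUpTo partner (ℓ ∸ k)

  offset-bound : ∀ {i} → i < ℓ ∸ k → i + suc k ≤ ℓ
  offset-bound {i} i<ℓ-k = subst (_≤ ℓ) (sym (+-suc i k)) (m≤o∸n⇒m+n≤o (suc i) k≤ℓ i<ℓ-k)

  index-offset : ∀ {j} → k < j → j ≤ ℓ → j ∸ suc k < ℓ ∸ k
  index-offset {j} k<j j≤ℓ = m+n≤o⇒m≤o∸n (suc (j ∸ suc k)) (subst (_≤ ℓ) j≡offset+k+1 j≤ℓ)
    where
    j≡offset+k+1 : j ≡ suc (j ∸ suc k) + k
    j≡offset+k+1 = trans (sym (m∸n+n≡m k<j)) (+-suc (j ∸ suc k) k)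

  x<F : ∀ i → x < fib (i + suc k)
  x<F i = <-≤-trans x<Fk+1 (fib-mono (m≤n+m (suc k) i))

  partners-length : length partners ≡ ℓ ∸ k
  partners-length = length-applyUpTo partner (ℓ ∸ k)

  -- Distinct offsets give distinct partners since F is strictly increasing.
  partners-unique : Unique partners
  partners-unique = applyUpTo⁺₁ partner (ℓ ∸ k) λ {i} i<j _ →
    <⇒≢ (∸-monoˡ-< (fib-strict (2≤index i) (+-monoˡ-< (suc k) i<j)) (<⇒≤ (x<F i)))
    where
    2≤index : ∀ i → 2 ≤ i + suc k
    2≤index i = ≤-trans 2≤k (≤-trans (n≤1+n k) (m≤n+m (suc k) i))

  -- A partner y with x + y = F j has k < j ≤ ℓ, because F k ≤ x < x + y ≤ x + n < F (ℓ+1).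
  partner→listed : ∀ {y} → Partner n x y → y ∈ partners
  partner→listed {y} ((1≤y , y≤n) , j , Fj≡x+y) =
    subst (_∈ partners) y≡partner (∈-applyUpTo⁺ partner (index-offset k<j j≤ℓ))
    where
    k<j : k < j
    k<j = fib-<-reflect (≤-<-trans Fk≤x (subst (x <_) (sym Fj≡x+y) (m<m+n x 1≤y)))
    j≤ℓ : j ≤ ℓ
    j≤ℓ = ≤-pred (fib-<-reflect (≤-<-trans (subst (_≤ x + n) (sym Fj≡x+y) (+-monoʳ-≤ x y≤n)) x+n<Fℓ+1))
    y≡partner : partner (j ∸ suc k) ≡ y
    y≡partner = begin
      fib (j ∸ suc k + suc k) ∸ x ≡⟨ cong (λ t → fib t ∸ x) (m∸n+n≡m k<j) ⟩
      fib j ∸ x                   ≡⟨ cong (_∸ x) Fj≡x+y ⟩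
      x + y ∸ x                   ≡⟨ m+n∸m≡n x y ⟩
      y                           ∎
      where open ≡-Reasoning

  -- Conversely F (i + k + 1) ∸ x is positive, at most F ℓ ∸ x ≤ n, and adds to x to F (i + k + 1).
  listed→partner : ∀ {y} → y ∈ partners → Partner n x y
  listed→partner p with i , i<ℓ-k , refl ← ∈-applyUpTo⁻ partner p =
    (m<n⇒0<n∸m (x<F i) , partner≤n) , i + suc k , sym (m+[n∸m]≡n (<⇒≤ (x<F i)))
    where
    partner≤n : partner i ≤ n
    partner≤n = subst (partner i ≤_) (m+n∸m≡n x n)
                  (∸-monoˡ-≤ x (≤-trans (fib-mono (offset-bound i<ℓ-k)) Fℓ≤x+n))

theorem4 : (n x k ℓ : ℕ) → 1 ≤ n → 1 ≤ x → x ≤ n →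
    2 ≤ k → fib k ≤ x → x < fib (k + 1) →
    k ≤ ℓ → fib ℓ ≤ x + n → x + n < fib (ℓ + 1) →
    (N : List ℕ) → Unique N → (∀ y → (y ∈ N) ⇔ Adj n x y) →
    (¬ IsFib (2 * x) → length N ≡ ℓ ∸ k)
    × (IsFib (2 * x) → length N ≡ ℓ ∸ k ∸ 1)
theorem4 n x k ℓ _ 1≤x x≤n 2≤k Fk≤x x<Fk+1 k≤ℓ Fℓ≤x+n x+n<Fℓ+1 N uN N⇔adj =
  (λ ¬fib2x → trans (length-without uN partners-unique (x∉partners ¬fib2x) N⇔partners)
                     partners-length)
  , (λ fib2x → trans (length-remove _≟_ uN partners-unique (x∈partners fib2x) N⇔partners)
                     (cong (_∸ 1) partners-length))
  where
  open Partners n x k ℓ 2≤k Fk≤x (subst (λ t → x < fib t) (+-comm k 1) x<Fk+1)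
                k≤ℓ Fℓ≤x+n (subst (λ t → x + n < fib t) (+-comm ℓ 1) x+n<Fℓ+1)
  x∈G : Vertex n x
  x∈G = 1≤x , x≤n

  N⇔partners : ∀ y → y ∈ N ⇔ (y ∈ partners × x ≢ y)
  N⇔partners y = mk⇔
    (λ y∈N → let (P , x≢y) = Equivalence.to (adj⇔partner x∈G) (Equivalence.to (N⇔adj y) y∈N)
             in partner→listed P , x≢y)
    (λ (y∈ , x≢y) → Equivalence.from (N⇔adj y)
                      (Equivalence.from (adj⇔partner x∈G) (listed→partner y∈ , x≢y)))

  x∉partners : ¬ IsFib (2 * x) → x ∉ partners
  x∉partners ¬fib2x x∈ = ¬fib2x (partner-self (listed→partner x∈))

  x∈partners : IsFib (2 * x) → x ∈ partners
  x∈partners fib2x = partner→listed (self-partner x∈G fib2x)
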